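{- Every $3$-graph $G$ on $n$ vertices with $\delta_1(G) \geq \frac{1}{2}\binom{n-1}{2}+1$ contains a spanning component.
   Context: A $3$-graph $G$ consists of a vertex set $V(G)$ and a set $E(G)$ of $3$-element subsets of $V(G)$ (edges). The minimum (vertex) degree $\delta_1(G)$ is the largest integer $m$ such that every vertex lies in at least $m$ edges. The line graph $L(G)$ is the graph on vertex set $E(G)$ in which $e,f$ are adjacent whenever $|e\cap f| = 2$. A subgraph of $G$ is (tightly) connected if it has no isolated vertices and its edges induce a connected subgraph of $L(G)$. A (tight) component is an edge-maximal connected subgraph. A component is spanning if its vertex set is all of $V(G)$. -}

module Defs where

open import Data.Nat using (ℕ; _+_; _*_; _≤_; _∸_)
open import Data.Nat.Combinatorics using (_C_)
open import Data.Fin using (Fin; _<_)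
open import Data.Product using (Σ; _×_; _,_; ∃-syntax)
open import Data.Sum using (_⊎_)
open import Data.List using (List; length; filter)
open import Data.List.Membership.Propositional using (_∈_)
open import Data.List.Relation.Unary.All using (All)
open import Data.List.Relation.Unary.Unique.Propositional using (Unique)
open import Relation.Binary.PropositionalEquality using (_≡_; _≢_)
open import Relation.Nullary using (¬_)
open import Level using (suc; zero)

-- A 3-element subset {a,b,c} of Fin n, written canonically as a triple with a < b < c.
Triple : ℕ → Set
Triple n = Fin n × Fin n × Fin n

Sorted : ∀ {n} → Triple n → Set
Sorted (a , b , c) = (a < b) × (b < c)

record ThreeGraph (n : ℕ) : Set where
  field
    edges  : List (Triple n)
    sorted : All Sorted edges
    unique : Unique edges
open ThreeGraph public

_∈ₑ_ : ∀ {n} → Fin n → Triple n → Set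
v ∈ₑ (a , b , c) = (v ≡ a) ⊎ (v ≡ b) ⊎ (v ≡ c)

degree : ∀ {n} → ThreeGraph n → Fin n → ℕ
degree {n} G v = length (filter (λ e → v ∈ₑ? e) (edges G))
  where
  open import Data.Fin.Properties using (_≟_)
  open import Relation.Nullary.Decidable using (_⊎-dec_)
  _∈ₑ?_ : (v : Fin n) (e : Triple n) → Relation.Nullary.Dec (v ∈ₑ e)
  v ∈ₑ? (a , b , c) = (v ≟ a) ⊎-dec ((v ≟ b) ⊎-dec (v ≟ c))
    where import Relation.Nullary

Inter2 : ∀ {n} → Triple n → Triple n → Set
Inter2 {n} e f = Σ (Fin n) λ u → Σ (Fin n) λ w →
  (u ≢ w) × (u ∈ₑ e) × (u ∈ₑ f) × (w ∈ₑ e) × (w ∈ₑ f) ×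
  (∀ x → x ∈ₑ e → x ∈ₑ f → (x ≡ u) ⊎ (x ≡ w))

LAdj : ∀ {n} → ThreeGraph n → Triple n → Triple n → Set
LAdj G e f = (e ∈ edges G) × (f ∈ edges G) × Inter2 e f

-- A subgraph of G, given by its edge set: a predicate on edges contained in E(G).
-- (Its vertex set is the set of vertices covered by its edges, so it has no isolated vertices.)
record Subgraph {n} (G : ThreeGraph n) : Set₁ where
  field
    inH : Triple n → Set
    sub : ∀ e → inH e → e ∈ edges G
open Subgraph public

data Walk {n} {G : ThreeGraph n} (H : Subgraph G) : Triple n → Triple n → Set where
  here : ∀ {e} → inH H e → Walk H e e
  step : ∀ {e f g} → inH H e → LAdj G e f → Walk H f g → Walk H e g

-- H is (tightly) connected: its edges induce a connected subgraph of L(G)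
Connected : ∀ {n} {G : ThreeGraph n} → Subgraph G → Set
Connected H = ∀ e f → inH H e → inH H f → Walk H e f

_⊆ₛ_ : ∀ {n} {G : ThreeGraph n} → Subgraph G → Subgraph G → Set
H ⊆ₛ H' = ∀ e → inH H e → inH H' e

IsComponent : ∀ {n} {G : ThreeGraph n} → Subgraph G → Set₁
IsComponent {G = G} H = Connected H × (∀ (H' : Subgraph G) → Connected H' → H ⊆ₛ H' → H' ⊆ₛ H)

Spanning : ∀ {n} {G : ThreeGraph n} → Subgraph G → Set
Spanning {n} H = ∀ (v : Fin n) → Σ (Triple n) λ e → inH H e × (v ∈ₑ e)

HasSpanningComponent : ∀ {n} → ThreeGraph n → Set₁
HasSpanningComponent G = Σ (Subgraph G) λ H → IsComponent H × Spanning H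

-- For an edge c and a vertex x let N_c(x) be the set of vertices y such that xy lies in an edge of
-- the tight component of c, and choose u and c with |N_c(u)| maximal. If that component meets every
-- vertex, it is spanning. Otherwise let w be a vertex it misses and c′ an edge with |N_c′(w)| maximal.
-- The link edges of w at a common vertex lie in one component, so the degree condition forces
-- |N_c′(w)| ≥ (n + 1)/2. Now compare the links of u and w, with S = N_c(u) and T = N_c′(w): an edge
-- uab has a and b on the same side of S, an edge wab has them on the same side of T, and both are
-- edges only for a, b ∉ S, as otherwise the component of c would reach w. As |T ∖ S| ≤ |S ∖ T| (by
-- the choice of u and c) and |V ∖ (S ∪ T ∪ {u, w})| ≤ |S ∩ T| (by the lower bound on |T|), counting
-- ordered pairs shows that u and w lie in at most C(n − 1, 2) edges together, contradicting the
-- degree condition.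

module Submission where

open import Defs
open import Data.Nat using (ℕ; _+_; _*_; _≤_; _∸_)
open import Data.Nat.Combinatorics using (_C_)

open import Data.Bool using (if_then_else_)
open import Data.Empty using (⊥; ⊥-elim)
open import Data.Fin as Fin using (Fin; zero; suc; punchIn)
open import Data.Fin.Properties as Finₚ using (_≟_; any?; all?; ¬∀⟶∃¬; punchInᵢ≢i)
open import Data.List using (List; []; _∷_; length; filter; cartesianProduct; allFin)
open import Data.List.Extrema.Nat using (argmax; argmax-sel; f[xs]≤f[argmax])
open import Data.List.Membership.Propositional using (_∈_; find; lose)
open import Data.List.Membership.Propositional.Properties
  using (∈-filter⁺; ∈-filter⁻; ∈-cartesianProduct⁺; ∈-cartesianProduct⁻; ∈-allFin)
import Data.List.Membership.DecPropositional as DecMembership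
open import Data.List.Properties using (filter-notAll)
open import Data.List.Relation.Binary.Subset.Propositional using (_⊆_)
open import Data.List.Relation.Unary.All using (All; _∷_) renaming (lookup to All-lookup)
open import Data.List.Relation.Unary.AllPairs using (_∷_)
open import Data.List.Relation.Unary.Any as Any using (Any; here; there)
open import Data.List.Relation.Unary.Unique.Propositional using (Unique)
open import Data.Nat using (zero; suc; z≤n; s≤s)
import Data.Nat as ℕ
open import Data.Nat.Combinatorics using (nC1≡n; nCk+nC[k+1]≡[n+1]C[k+1])
open import Data.Nat.Properties hiding (_≟_)
open import Data.Nat.Tactic.RingSolver using (solve-∀)
open import Data.Product using (Σ; Σ-syntax; _×_; _,_; proj₁; proj₂)
open import Data.Product.Properties using (≡-dec)
open import Data.Sum using (_⊎_; inj₁; inj₂)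
open import Data.Unit using (tt)
open import Function using (_∘_)
open import Level using (Level)
open import Relation.Binary.Definitions using (DecidableEquality)
open import Relation.Binary.PropositionalEquality
open import Relation.Nullary using (Dec; yes; no; does; ¬_; contradiction)
open import Relation.Nullary.Decidable using (map′; ¬?; _×-dec_; _⊎-dec_; _→-dec_)
open import Relation.Unary using (Decidable)
open import Algebra.Properties.Semiring.Sum +-*-semiring
  using (sum; sum-syntax; sum-cong-≗; ∑-distrib-+; *-distribˡ-sum; *-distribʳ-sum; sum-remove)

private
  variable
    ℓ ℓ′ ℓ″ : Level
    P : Set ℓ
    Q : Set ℓ′
    R : Set ℓ″

𝟙 : Dec P → ℕ
𝟙 d = if does d then 1 else 0

𝟙-yes : (d : Dec P) → P → 𝟙 d ≡ 1
𝟙-yes (yes _) _  = refl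
𝟙-yes (no ¬p) p = ⊥-elim (¬p p)

𝟙-no : (d : Dec P) → ¬ P → 𝟙 d ≡ 0
𝟙-no (yes p) ¬p = ⊥-elim (¬p p)
𝟙-no (no _)  _  = refl

𝟙≤1 : (d : Dec P) → 𝟙 d ≤ 1
𝟙≤1 (yes _) = ≤-refl
𝟙≤1 (no _)  = z≤n

𝟙-idem : (d : Dec P) → 𝟙 d * 𝟙 d ≡ 𝟙 d
𝟙-idem (yes _) = refl
𝟙-idem (no _)  = refl

𝟙-¬+𝟙 : (d : Dec P) → 𝟙 (¬? d) + 𝟙 d ≡ 1
𝟙-¬+𝟙 (yes _) = refl
𝟙-¬+𝟙 (no _)  = refl

𝟙-mono : (d : Dec P) (e : Dec Q) → (P → Q) → 𝟙 d ≤ 𝟙 e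
𝟙-mono (yes p) e P→Q = ≤-reflexive (sym (𝟙-yes e (P→Q p)))
𝟙-mono (no _)  e _   = z≤n

𝟙-disjoint : (d : Dec P) (e : Dec Q) (r : Dec R) → (P → R) → (Q → R) → ¬ (P × Q) → 𝟙 d + 𝟙 e ≤ 𝟙 r
𝟙-disjoint (yes p) (yes q) _ _   _   ¬p×q = ⊥-elim (¬p×q (p , q))
𝟙-disjoint (yes p) (no _)  r P→R _   _    = 𝟙-mono (yes p) r P→R
𝟙-disjoint (no _)  e       r _   Q→R _    = 𝟙-mono e r Q→R

𝟙-exclusive : (d : Dec P) (e : Dec Q) → ¬ (P × Q) → 𝟙 d + 𝟙 e ≤ 1
𝟙-exclusive d e = 𝟙-disjoint d e (yes tt) (λ _ → tt) (λ _ → tt)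

∑∑ : ∀ {n} → (Fin n → Fin n → ℕ) → ℕ
∑∑ {n} f = ∑[ a < n ] ∑[ b < n ] f a b

sum-mono-≤ : ∀ {n} {f g : Fin n → ℕ} → (∀ i → f i ≤ g i) → sum f ≤ sum g
sum-mono-≤ {zero}  _   = z≤n
sum-mono-≤ {suc n} f≤g = +-mono-≤ (f≤g zero) (sum-mono-≤ (f≤g ∘ suc))

∑∑-mono-≤ : ∀ {n} {f g : Fin n → Fin n → ℕ} → (∀ a b → f a b ≤ g a b) → ∑∑ f ≤ ∑∑ g
∑∑-mono-≤ f≤g = sum-mono-≤ λ a → sum-mono-≤ (f≤g a)

sum-const : ∀ n k → ∑[ i < n ] k ≡ n * k
sum-const zero    k = refl
sum-const (suc n) k = cong (k +_) (sum-const n k)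

sum-zero : ∀ {n} {f : Fin n → ℕ} → (∀ i → f i ≡ 0) → sum f ≡ 0
sum-zero {n} f≡0 = trans (sum-cong-≗ f≡0) (trans (sum-const n 0) (*-zeroʳ n))

sum-one : ∀ {n} (f : Fin n → ℕ) i → f i ≤ sum f
sum-one f zero    = m≤m+n _ _
sum-one f (suc i) = ≤-trans (sum-one (f ∘ suc) i) (m≤n+m _ _)

sum-two : ∀ {n} (f : Fin n → ℕ) {i j} → i ≢ j → f i + f j ≤ sum f
sum-two f {zero}  {zero}  i≢j = ⊥-elim (i≢j refl)
sum-two f {zero}  {suc j} _   = +-monoʳ-≤ (f zero) (sum-one (f ∘ suc) j)
sum-two f {suc i} {zero}  _   = ≤-trans (≤-reflexive (+-comm (f (suc i)) (f zero))) (sum-two f {zero} {suc i} λ ())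
sum-two f {suc i} {suc j} i≢j = ≤-trans (sum-two (f ∘ suc) (i≢j ∘ cong suc)) (m≤n+m _ (f zero))

sum-except : ∀ {n k} (i : Fin n) (f : Fin n → ℕ) → f i ≡ 0 → (∀ j → f j ≤ k) → sum f ≤ (n ∸ 1) * k
sum-except {suc n} {k} i f fi≡0 f≤k = begin
  sum f                             ≡⟨ sum-remove {i = i} f ⟩
  f i + ∑[ j < n ] f (punchIn i j)  ≡⟨ cong (_+ ∑[ j < n ] f (punchIn i j)) fi≡0 ⟩
  ∑[ j < n ] f (punchIn i j)        ≤⟨ sum-mono-≤ (f≤k ∘ punchIn i) ⟩
  ∑[ j < n ] k                      ≡⟨ sum-const n k ⟩
  n * k                             ∎
  where open ≤-Reasoning

sum-δ : ∀ {n} (i : Fin n) (f : Fin n → ℕ) → ∑[ j < n ] (𝟙 (i ≟ j) * f j) ≡ f i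
sum-δ {suc n} i f = begin
  ∑[ j < suc n ] (𝟙 (i ≟ j) * f j)                                     ≡⟨ sum-remove {i = i} (λ j → 𝟙 (i ≟ j) * f j) ⟩
  𝟙 (i ≟ i) * f i + ∑[ j < n ] (𝟙 (i ≟ punchIn i j) * f (punchIn i j)) ≡⟨ cong₂ _+_ at-i elsewhere ⟩
  f i + 0                                                                ≡⟨ +-identityʳ (f i) ⟩
  f i                                                                    ∎
  where
  open ≡-Reasoning
  at-i : 𝟙 (i ≟ i) * f i ≡ f i
  at-i = trans (cong (_* f i) (𝟙-yes (i ≟ i) refl)) (*-identityˡ (f i))
  elsewhere : ∑[ j < n ] (𝟙 (i ≟ punchIn i j) * f (punchIn i j)) ≡ 0
  elsewhere = sum-zero λ j → cong (_* f (punchIn i j)) (𝟙-no (i ≟ punchIn i j) (punchInᵢ≢i i j ∘ sym))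

sum-δ₁ : ∀ {n} (i : Fin n) → ∑[ j < n ] 𝟙 (i ≟ j) ≡ 1
sum-δ₁ i = trans (sum-cong-≗ λ j → sym (*-identityʳ (𝟙 (i ≟ j)))) (sum-δ i (λ _ → 1))

∑∑-distrib-+ : ∀ {n} (f g : Fin n → Fin n → ℕ) → ∑∑ (λ a b → f a b + g a b) ≡ ∑∑ f + ∑∑ g
∑∑-distrib-+ f g =
  trans (sum-cong-≗ λ a → ∑-distrib-+ (f a) (g a)) (∑-distrib-+ (λ a → sum (f a)) (λ a → sum (g a)))

∑∑-product : ∀ {n} (p q : Fin n → ℕ) → ∑∑ (λ a b → p a * q b) ≡ sum p * sum q
∑∑-product {n} p q = begin
  ∑∑ (λ a b → p a * q b)    ≡⟨ sum-cong-≗ (λ a → *-distribˡ-sum (p a) q) ⟨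
  ∑[ a < n ] (p a * sum q)  ≡⟨ *-distribʳ-sum (sum q) p ⟨
  sum p * sum q             ∎
  where open ≡-Reasoning

∑∑-offDiagonal : ∀ {n} (p : Fin n → ℕ) → (∀ a → p a * p a ≡ p a) →
                 ∑∑ (λ a b → 𝟙 (¬? (a ≟ b)) * (p a * p b)) + sum p ≡ sum p * sum p
∑∑-offDiagonal {n} p idem = begin
  ∑∑ off + sum p               ≡⟨ cong (∑∑ off +_) (sum-cong-≗ diagonal) ⟨
  ∑∑ off + ∑∑ on               ≡⟨ ∑∑-distrib-+ off on ⟨
  ∑∑ (λ a b → off a b + on a b) ≡⟨ sum-cong-≗ (λ a → sum-cong-≗ (split a)) ⟩
  ∑∑ (λ a b → p a * p b)       ≡⟨ ∑∑-product p p ⟩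
  sum p * sum p                ∎
  where
  open ≡-Reasoning
  off on : Fin n → Fin n → ℕ
  off a b = 𝟙 (¬? (a ≟ b)) * (p a * p b)
  on  a b = 𝟙 (a ≟ b) * (p a * p b)
  diagonal : ∀ a → sum (on a) ≡ p a
  diagonal a = trans (sum-δ a (λ b → p a * p b)) (idem a)
  split : ∀ a b → off a b + on a b ≡ p a * p b
  split a b = trans (sym (*-distribʳ-+ (p a * p b) (𝟙 (¬? (a ≟ b))) (𝟙 (a ≟ b))))
                    (trans (cong (_* (p a * p b)) (𝟙-¬+𝟙 (a ≟ b))) (*-identityˡ (p a * p b)))

module _ {A : Set} (f : A → ℕ) {a₀ : A} {xs : List A} where

  argmax-∈ : a₀ ∈ xs → argmax f a₀ xs ∈ xs
  argmax-∈ a₀∈xs with argmax-sel f a₀ xs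
  ... | inj₁ argmax≡a₀ = subst (_∈ xs) (sym argmax≡a₀) a₀∈xs
  ... | inj₂ argmax∈xs = argmax∈xs

  argmax-maximal : ∀ {a} → a ∈ xs → f a ≤ f (argmax f a₀ xs)
  argmax-maximal = All-lookup (f[xs]≤f[argmax] a₀ xs)

filter-nonempty : ∀ {A : Set} {P : A → Set} (P? : Decidable P) xs → 1 ≤ length (filter P? xs) → Σ A (_∈ xs)
filter-nonempty P? (x ∷ _) _ = x , here refl

2*mC2+m≡m*m : ∀ m → 2 * (m C 2) + m ≡ m * m
2*mC2+m≡m*m zero    = refl
2*mC2+m≡m*m (suc m) = begin
  2 * (suc m C 2) + suc m          ≡⟨ cong (λ k → 2 * k + suc m) (nCk+nC[k+1]≡[n+1]C[k+1] m 1) ⟨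
  2 * (m C 1 + m C 2) + suc m      ≡⟨ cong (λ k → 2 * (k + m C 2) + suc m) (nC1≡n m) ⟩
  2 * (m + m C 2) + suc m          ≡⟨ regroup m (m C 2) ⟩
  (2 * (m C 2) + m) + suc (2 * m)  ≡⟨ cong (_+ suc (2 * m)) (2*mC2+m≡m*m m) ⟩
  m * m + suc (2 * m)              ≡⟨ square m ⟩
  suc m * suc m                    ∎
  where
  open ≡-Reasoning
  regroup : ∀ m c → 2 * (m + c) + suc m ≡ (2 * c + m) + suc (2 * m)
  regroup = solve-∀
  square : ∀ m → m * m + suc (2 * m) ≡ suc m * suc m
  square = solve-∀

mC2+2≤m*[t∸1]⇒m+2≤2*t : ∀ m t → m C 2 + 2 ≤ m * (t ∸ 1) → m + 2 ≤ 2 * t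
mC2+2≤m*[t∸1]⇒m+2≤2*t m zero    h =
  contradiction (≤-trans (m≤n+m 2 (m C 2)) (≤-trans h (≤-reflexive (*-zeroʳ m)))) λ ()
mC2+2≤m*[t∸1]⇒m+2≤2*t m (suc k) h with m ≤? 2 * k
... | yes m≤2k = ≤-trans (+-monoˡ-≤ 2 m≤2k) (≤-reflexive (double-suc k))
  where
  double-suc : ∀ k → 2 * k + 2 ≡ 2 * suc k
  double-suc = solve-∀
... | no m≰2k = contradiction (+-cancelʳ-≤ S 4 0 (begin
    4 + S                   ≡⟨ shuffle (m C 2) m ⟩
    2 * (m C 2 + 2) + m     ≤⟨ +-monoˡ-≤ m (*-monoʳ-≤ 2 h) ⟩
    2 * (m * k) + m         ≡⟨ factor m k ⟩
    m * suc (2 * k)         ≤⟨ *-monoʳ-≤ m (≰⇒> m≰2k) ⟩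
    m * m                   ≡⟨ 2*mC2+m≡m*m m ⟨
    S                       ∎)) λ ()
  where
  open ≤-Reasoning
  S : ℕ
  S = 2 * (m C 2) + m
  shuffle : ∀ c m → 4 + (2 * c + m) ≡ 2 * (c + 2) + m
  shuffle = solve-∀
  factor : ∀ m k → 2 * (m * k) + m ≡ m * suc (2 * k)
  factor = solve-∀

b≤a⇒b*b+b≤a*b+b*a : ∀ {a b} → b ≤ a → b * b + b ≤ a * b + b * a
b≤a⇒b*b+b≤a*b+b*a {a} {zero}  _   = z≤n
b≤a⇒b*b+b≤a*b+b*a {a} {suc b} b<a = +-mono-≤ (*-monoˡ-≤ (suc b) b<a) (begin
  suc b      ≡⟨ *-identityʳ (suc b) ⟨
  suc b * 1  ≤⟨ *-monoʳ-≤ (suc b) (≤-trans (s≤s z≤n) b<a) ⟩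
  suc b * a  ∎)
  where open ≤-Reasoning

-- ON, OB and OR stand for the numbers of ordered pairs of distinct elements in sets of sizes m, cb and cr.
no-room : ∀ {m ca cb ci cr ON OB OR} → cb ≤ ca → cr ≤ ci →
          ON + m ≡ m * m → OB + cb ≡ cb * cb → OR + cr ≡ cr * cr →
          (m C 2 + 2) + (m C 2 + 2) + (ca * cb + cb * ca + ci * cr + cr * ci)
            ≤ ON + OB + OR + (1 * (cb + cr) + (cb + cr) * 1) →
          ⊥
no-room {m} {ca} {cb} {ci} {cr} {ON} {OB} {OR} cb≤ca cr≤ci ON+m OB+cb OR+cr counted =
  contradiction (+-cancelʳ-≤ X 4 0 (begin
    4 + X                                      ≤⟨ excess ⟩
    (cb * cb + cb) + (cr * cr + cr)            ≤⟨ +-mono-≤ (b≤a⇒b*b+b≤a*b+b*a cb≤ca) (b≤a⇒b*b+b≤a*b+b*a cr≤ci) ⟩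
    (ca * cb + cb * ca) + (ci * cr + cr * ci)  ≡⟨ +-assoc (ca * cb + cb * ca) (ci * cr) (cr * ci) ⟨
    0 + X                                      ∎)) λ ()
  where
  open ≤-Reasoning
  X K : ℕ
  X = ca * cb + cb * ca + ci * cr + cr * ci
  K = m * m + (cb + cr)
  excess : 4 + X ≤ (cb * cb + cb) + (cr * cr + cr)
  excess = +-cancelʳ-≤ K (4 + X) _ (begin
    4 + X + K                                         ≡⟨ cong (λ mm → 4 + X + (mm + (cb + cr))) (2*mC2+m≡m*m m) ⟨
    4 + X + (2 * (m C 2) + m + (cb + cr))             ≡⟨ lhs-shape (m C 2) X m cb cr ⟩
    (m C 2 + 2) + (m C 2 + 2) + X + (m + (cb + cr))   ≤⟨ +-monoˡ-≤ (m + (cb + cr)) counted ⟩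
    ON + OB + OR + (1 * (cb + cr) + (cb + cr) * 1) + (m + (cb + cr))
                                                      ≡⟨ rhs-shape ON OB OR m cb cr ⟩
    (ON + m) + (OB + cb) + (OR + cr) + (cb + cr) + (cb + cr)
                                                      ≡⟨ cong₂ (λ p q → p + q + (cb + cr) + (cb + cr))
                                                               (cong₂ _+_ ON+m OB+cb) OR+cr ⟩
    m * m + cb * cb + cr * cr + (cb + cr) + (cb + cr) ≡⟨ regroup (m * m) cb cr ⟩
    (cb * cb + cb) + (cr * cr + cr) + K               ∎)
    where
    lhs-shape : ∀ c X m cb cr → 4 + X + (2 * c + m + (cb + cr)) ≡ (c + 2) + (c + 2) + X + (m + (cb + cr))
    lhs-shape = solve-∀
    rhs-shape : ∀ ON OB OR m cb cr → ON + OB + OR + (1 * (cb + cr) + (cb + cr) * 1) + (m + (cb + cr))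
                                   ≡ (ON + m) + (OB + cb) + (OR + cr) + (cb + cr) + (cb + cr)
    rhs-shape = solve-∀
    regroup : ∀ M cb cr → M + cb * cb + cr * cr + (cb + cr) + (cb + cr)
                        ≡ (cb * cb + cb) + (cr * cr + cr) + (M + (cb + cr))
    regroup = solve-∀

module _ {n : ℕ} where

  Distinct : Fin n → Fin n → Fin n → Set
  Distinct x y z = x ≢ y × y ≢ z × x ≢ z

  In₃ : Fin n → Fin n → Fin n → Triple n → Set
  In₃ x y z e = x ∈ₑ e × y ∈ₑ e × z ∈ₑ e

  _≟ₜ_ : DecidableEquality (Triple n)
  _≟ₜ_ = ≡-dec _≟_ (≡-dec _≟_ _≟_)

  _∈ₑ?_ : (v : Fin n) (e : Triple n) → Dec (v ∈ₑ e)
  v ∈ₑ? (a , b , c) = (v ≟ a) ⊎-dec ((v ≟ b) ⊎-dec (v ≟ c))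

  ∈ₑ-In₃ : ∀ {x y z v : Fin n} {e} → v ∈ₑ (x , y , z) → In₃ x y z e → v ∈ₑ e
  ∈ₑ-In₃ (inj₁ refl)        (x∈ , _ , _) = x∈
  ∈ₑ-In₃ (inj₂ (inj₁ refl)) (_ , y∈ , _) = y∈
  ∈ₑ-In₃ (inj₂ (inj₂ refl)) (_ , _ , z∈) = z∈

  ∈ₑ-others : ∀ {v : Fin n} {e} → v ∈ₑ e →
              Σ (Fin n) λ a → Σ (Fin n) λ b → ∀ x → x ∈ₑ e → x ≢ v → x ≡ a ⊎ x ≡ b
  ∈ₑ-others {e = p , q , r} (inj₁ refl) = q , r , λ where
    x (inj₁ x≡p) x≢p → ⊥-elim (x≢p x≡p)
    x (inj₂ x∈qr) _  → x∈qr
  ∈ₑ-others {e = p , q , r} (inj₂ (inj₁ refl)) = p , r , λ where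
    x (inj₁ x≡p)        _   → inj₁ x≡p
    x (inj₂ (inj₁ x≡q)) x≢q → ⊥-elim (x≢q x≡q)
    x (inj₂ (inj₂ x≡r)) _   → inj₂ x≡r
  ∈ₑ-others {e = p , q , r} (inj₂ (inj₂ refl)) = p , q , λ where
    x (inj₁ x≡p)        _   → inj₁ x≡p
    x (inj₂ (inj₁ x≡q)) _   → inj₂ x≡q
    x (inj₂ (inj₂ x≡r)) x≢r → ⊥-elim (x≢r x≡r)

  pigeonhole₃₂ : ∀ {a b x y z : Fin n} →
                 x ≡ a ⊎ x ≡ b → y ≡ a ⊎ y ≡ b → z ≡ a ⊎ z ≡ b → ¬ Distinct x y z
  pigeonhole₃₂ (inj₁ refl) (inj₁ refl) _           (x≢y , _ , _) = x≢y refl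
  pigeonhole₃₂ (inj₂ refl) (inj₂ refl) _           (x≢y , _ , _) = x≢y refl
  pigeonhole₃₂ _           (inj₁ refl) (inj₁ refl) (_ , y≢z , _) = y≢z refl
  pigeonhole₃₂ _           (inj₂ refl) (inj₂ refl) (_ , y≢z , _) = y≢z refl
  pigeonhole₃₂ (inj₁ refl) _           (inj₁ refl) (_ , _ , x≢z) = x≢z refl
  pigeonhole₃₂ (inj₂ refl) _           (inj₂ refl) (_ , _ , x≢z) = x≢z refl

  In₃-exhausts : ∀ {x y z v : Fin n} {e} → Distinct x y z → In₃ x y z e → v ∈ₑ e → v ∈ₑ (x , y , z)
  In₃-exhausts {x} {y} {z} {v} d (x∈ , y∈ , z∈) v∈ with v ≟ x | v ≟ y | v ≟ z
  ... | yes v≡x | _       | _       = inj₁ v≡x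
  ... | no _    | yes v≡y | _       = inj₂ (inj₁ v≡y)
  ... | no _    | no _    | yes v≡z = inj₂ (inj₂ v≡z)
  ... | no v≢x  | no v≢y  | no v≢z  with ∈ₑ-others v∈
  ...   | _ , _ , others =
    ⊥-elim (pigeonhole₃₂ (others x x∈ (v≢x ∘ sym)) (others y y∈ (v≢y ∘ sym)) (others z z∈ (v≢z ∘ sym)) d)

  Sorted-min : ∀ {p q r v : Fin n} → Sorted (p , q , r) → v ∈ₑ (p , q , r) → p Fin.≤ v
  Sorted-min _           (inj₁ refl)        = Finₚ.≤-refl
  Sorted-min (p<q , _)   (inj₂ (inj₁ refl)) = <⇒≤ p<q
  Sorted-min (p<q , q<r) (inj₂ (inj₂ refl)) = <⇒≤ (<-trans p<q q<r)

  Sorted-max : ∀ {p q r v : Fin n} → Sorted (p , q , r) → v ∈ₑ (p , q , r) → v Fin.≤ r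
  Sorted-max (p<q , q<r) (inj₁ refl)        = <⇒≤ (<-trans p<q q<r)
  Sorted-max (_ , q<r)   (inj₂ (inj₁ refl)) = <⇒≤ q<r
  Sorted-max _           (inj₂ (inj₂ refl)) = Finₚ.≤-refl

  Sorted-unique : ∀ {e f : Triple n} → Sorted e → Sorted f →
                  (∀ {v} → v ∈ₑ e → v ∈ₑ f) → (∀ {v} → v ∈ₑ f → v ∈ₑ e) → e ≡ f
  Sorted-unique {p , q , r} {p′ , q′ , r′} sorted-e@(p<q , q<r) sorted-f e⊆f f⊆e =
    cong₂ _,_ p≡p′ (cong₂ _,_ q≡q′ r≡r′)
    where
    p≡p′ : p ≡ p′
    p≡p′ = Finₚ.≤-antisym (Sorted-min sorted-e (f⊆e (inj₁ refl))) (Sorted-min sorted-f (e⊆f (inj₁ refl)))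
    r≡r′ : r ≡ r′
    r≡r′ = Finₚ.≤-antisym (Sorted-max sorted-f (e⊆f (inj₂ (inj₂ refl))))
                          (Sorted-max sorted-e (f⊆e (inj₂ (inj₂ refl))))
    q≡q′ : q ≡ q′
    q≡q′ with e⊆f (inj₂ (inj₁ refl))
    ... | inj₁ q≡p′        = ⊥-elim (Finₚ.<⇒≢ p<q (trans p≡p′ (sym q≡p′)))
    ... | inj₂ (inj₁ q≡q′) = q≡q′
    ... | inj₂ (inj₂ q≡r′) = ⊥-elim (Finₚ.<⇒≢ q<r (trans q≡r′ (sym r≡r′)))

  same-edge : ∀ {x y z : Fin n} {e f} → Sorted e → Sorted f → Distinct x y z → In₃ x y z e → In₃ x y z f → e ≡ f
  same-edge sorted-e sorted-f d xyz∈e xyz∈f = Sorted-unique sorted-e sorted-f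
    (λ v∈e → ∈ₑ-In₃ (In₃-exhausts d xyz∈e v∈e) xyz∈f)
    (λ v∈f → ∈ₑ-In₃ (In₃-exhausts d xyz∈f v∈f) xyz∈e)

  Sorted-others : ∀ {x : Fin n} {e} → Sorted e → x ∈ₑ e →
                  Σ (Fin n) λ y → Σ (Fin n) λ z → Distinct x y z × In₃ x y z e
  Sorted-others (p<q , q<r) (inj₁ refl) =
    _ , _ , (Finₚ.<⇒≢ p<q , Finₚ.<⇒≢ q<r , Finₚ.<⇒≢ (<-trans p<q q<r)) ,
    inj₁ refl , inj₂ (inj₁ refl) , inj₂ (inj₂ refl)
  Sorted-others (p<q , q<r) (inj₂ (inj₁ refl)) =
    _ , _ , (Finₚ.<⇒≢ p<q ∘ sym , Finₚ.<⇒≢ (<-trans p<q q<r) , Finₚ.<⇒≢ q<r) ,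
    inj₂ (inj₁ refl) , inj₁ refl , inj₂ (inj₂ refl)
  Sorted-others (p<q , q<r) (inj₂ (inj₂ refl)) =
    _ , _ , (Finₚ.<⇒≢ (<-trans p<q q<r) ∘ sym , Finₚ.<⇒≢ p<q , Finₚ.<⇒≢ q<r ∘ sym) ,
    inj₂ (inj₂ refl) , inj₁ refl , inj₂ (inj₁ refl)

  Inter2-sym : ∀ {e f : Triple n} → Inter2 e f → Inter2 f e
  Inter2-sym (u , w , u≢w , u∈e , u∈f , w∈e , w∈f , only) =
    u , w , u≢w , u∈f , u∈e , w∈f , w∈e , λ x x∈f x∈e → only x x∈e x∈f

  inter2? : (e f : Triple n) → Dec (Inter2 e f)
  inter2? e f = any? λ u → any? λ w →
    ¬? (u ≟ w) ×-dec (u ∈ₑ? e) ×-dec (u ∈ₑ? f) ×-dec (w ∈ₑ? e) ×-dec (w ∈ₑ? f) ×-dec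
    all? λ x → (x ∈ₑ? e) →-dec ((x ∈ₑ? f) →-dec ((x ≟ u) ⊎-dec (x ≟ w)))

no-vertices : (G : ThreeGraph 0) → HasSpanningComponent G
no-vertices G = empty , ((λ _ _ ()) , maximal) , λ ()
  where
  empty : Subgraph G
  empty = record { inH = λ _ → ⊥ ; sub = λ _ () }
  maximal : ∀ H → Connected H → empty ⊆ₛ H → H ⊆ₛ empty
  maximal _ _ _ (() , _) _

module Tight {n : ℕ} (G : ThreeGraph n) where

  open DecMembership (_≟ₜ_ {n}) using (_∈?_)

  E : List (Triple n)
  E = edges G

  whole : Subgraph G
  whole = record { inH = _∈ E ; sub = λ _ e∈E → e∈E }

  Reach : Triple n → Triple n → Set
  Reach = Walk whole

  module _ {H : Subgraph G} where

    walk-start : ∀ {e f} → Walk H e f → inH H e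
    walk-start (here e∈H)     = e∈H
    walk-start (step e∈H _ _) = e∈H

    walk-end : ∀ {e f} → Walk H e f → inH H f
    walk-end (here f∈H)      = f∈H
    walk-end (step _ _ rest) = walk-end rest

    infixr 5 _++ʷ_
    _++ʷ_ : ∀ {e f g} → Walk H e f → Walk H f g → Walk H e g
    here _            ++ʷ rest′ = rest′
    step e∈H e~f rest ++ʷ rest′ = step e∈H e~f (rest ++ʷ rest′)

    walk-reverse : ∀ {e f} → Walk H e f → Walk H f e
    walk-reverse (here e∈H) = here e∈H
    walk-reverse (step e∈H (e∈E , f∈E , e∩f) rest) =
      walk-reverse rest ++ʷ step (walk-start rest) (f∈E , e∈E , Inter2-sym e∩f) (here e∈H)

    walk-forget : ∀ {e f} → Walk H e f → Reach e f
    walk-forget (here e∈H)         = here (sub H _ e∈H)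
    walk-forget (step e∈H e~f rest) = step (sub H _ e∈H) e~f (walk-forget rest)

  reach-step : ∀ {c e f} → Reach c e → f ∈ E → Inter2 e f → Reach c f
  reach-step c⇝e f∈E e∩f = c⇝e ++ʷ step (walk-end c⇝e) (walk-end c⇝e , f∈E , e∩f) (here f∈E)

  reach-sharing : ∀ {e f a b} → e ∈ E → f ∈ E → a ≢ b →
                  a ∈ₑ e → b ∈ₑ e → a ∈ₑ f → b ∈ₑ f → Reach e f
  reach-sharing {e} {f} {a} {b} e∈E f∈E a≢b a∈e b∈e a∈f b∈f with e ≟ₜ f
  ... | yes refl = here e∈E
  ... | no e≢f   = reach-step (here e∈E) f∈E (a , b , a≢b , a∈e , a∈f , b∈e , b∈f , only-a-b)
    where
    only-a-b : ∀ x → x ∈ₑ e → x ∈ₑ f → x ≡ a ⊎ x ≡ b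
    only-a-b x x∈e x∈f with x ≟ a | x ≟ b
    ... | yes x≡a | _       = inj₁ x≡a
    ... | no _    | yes x≡b = inj₂ x≡b
    ... | no x≢a  | no x≢b  = ⊥-elim (e≢f (same-edge (All-lookup (sorted G) e∈E) (All-lookup (sorted G) f∈E)
                                (a≢b , x≢b ∘ sym , x≢a ∘ sym) (a∈e , b∈e , x∈e) (a∈f , b∈f , x∈f)))

  Closed : List (Triple n) → Set
  Closed K = ∀ {k f} → k ∈ K → f ∈ E → Inter2 k f → f ∈ K

  closed-reach : ∀ {K k e} → Closed K → k ∈ K → Reach k e → e ∈ K
  closed-reach closed k∈K (here _)                      = k∈K
  closed-reach closed k∈K (step _ (_ , f∈E , k∩f) rest) = closed-reach closed (closed k∈K f∈E k∩f) rest

  record Frontier (c : Triple n) (K R : List (Triple n)) : Set where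
    field
      reached   : ∀ {k} → k ∈ K → Reach c k
      unvisited : R ⊆ E
      covers    : ∀ {e} → e ∈ E → e ∈ K ⊎ e ∈ R

  explore : ∀ {c} fuel K R → length R ≤ fuel → Frontier c K R →
            Σ[ K′ ∈ List (Triple n) ] (∀ {k} → k ∈ K′ → Reach c k) × Closed K′ × K ⊆ K′
  explore fuel K R _ frontier with Any.any? (λ f → Any.any? (λ k → inter2? k f) K) R
  ... | no stuck = K , reached , closed , λ k∈K → k∈K
    where
    open Frontier frontier
    closed : Closed K
    closed k∈K f∈E k∩f with covers f∈E
    ... | inj₁ f∈K = f∈K
    ... | inj₂ f∈R = ⊥-elim (stuck (lose f∈R (lose k∈K k∩f)))
  explore zero       K [] _ _ | yes ()
  explore (suc fuel) K R R≤fuel frontier | yes found with find found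
  ... | f , f∈R , K∩f with find K∩f
  ... | k , k∈K , k∩f with explore fuel (f ∷ K) R′ R′≤fuel frontier′
    where
    open Frontier frontier
    R′ : List (Triple n)
    R′ = filter (λ e → ¬? (e ≟ₜ f)) R
    R′≤fuel : length R′ ≤ fuel
    R′≤fuel = ≤-pred (≤-trans (filter-notAll _ R (Any.map (λ f≡e e≢f → e≢f (sym f≡e)) f∈R)) R≤fuel)
    frontier′ : Frontier _ (f ∷ K) R′
    Frontier.reached frontier′ (here refl)   = reach-step (reached k∈K) (unvisited f∈R) k∩f
    Frontier.reached frontier′ (there k∈K)   = reached k∈K
    Frontier.unvisited frontier′ e∈R′        = unvisited (proj₁ (∈-filter⁻ _ e∈R′))
    Frontier.covers frontier′ {e} e∈E with covers e∈E
    ... | inj₁ e∈K = inj₁ (there e∈K)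
    ... | inj₂ e∈R with e ≟ₜ f
    ...   | yes refl = inj₁ (here refl)
    ...   | no e≢f   = inj₂ (∈-filter⁺ _ e∈R e≢f)
  ... | K′ , reached′ , closed′ , f∷K⊆K′ = K′ , reached′ , closed′ , f∷K⊆K′ ∘ there

  reach? : ∀ c e → Dec (Reach c e)
  reach? c e with c ∈? E
  ... | no c∉E = no (c∉E ∘ walk-start)
  ... | yes c∈E with explore (length E) (c ∷ []) E ≤-refl start
    where
    start : Frontier c (c ∷ []) E
    Frontier.reached start (here refl) = here c∈E
    Frontier.unvisited start e∈E       = e∈E
    Frontier.covers start e∈E          = inj₂ e∈E
  ... | K , reached , closed , c∈K with e ∈? K
  ...   | yes e∈K = yes (reached e∈K)
  ...   | no e∉K  = no (e∉K ∘ closed-reach closed (c∈K (here refl)))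

  componentOf : Triple n → Subgraph G
  componentOf c = record { inH = Reach c ; sub = λ _ → walk-end }

  walk-within : ∀ {c e f} → Reach c e → Reach e f → Walk (componentOf c) e f
  walk-within c⇝e (here _)                       = here c⇝e
  walk-within c⇝e (step _ e~f@(_ , f∈E , e∩f) rest) = step c⇝e e~f (walk-within (reach-step c⇝e f∈E e∩f) rest)

  componentOf-isComponent : ∀ {c} → c ∈ E → IsComponent (componentOf c)
  componentOf-isComponent {c} c∈E = connected , maximal
    where
    connected : Connected (componentOf c)
    connected _ _ c⇝e c⇝f = walk-within c⇝e (walk-reverse c⇝e ++ʷ c⇝f)
    maximal : ∀ H → Connected H → componentOf c ⊆ₛ H → H ⊆ₛ componentOf c
    maximal H H-connected c⊆H e e∈H = walk-forget (H-connected c e (c⊆H c (here c∈E)) e∈H)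

  Link : List (Triple n) → Fin n → Fin n → Fin n → Set
  Link xs x a b = Distinct x a b × Any (In₃ x a b) xs

  link? : ∀ xs x a b → Dec (Link xs x a b)
  link? xs x a b = (¬? (x ≟ a) ×-dec ¬? (a ≟ b) ×-dec ¬? (x ≟ b)) ×-dec
                   Any.any? (λ e → (x ∈ₑ? e) ×-dec (a ∈ₑ? e) ×-dec (b ∈ₑ? e)) xs

  Nbr : Triple n → Fin n → Fin n → Set
  Nbr c x y = x ≢ y × Any (λ e → x ∈ₑ e × y ∈ₑ e × Reach c e) E

  nbr? : ∀ c x y → Dec (Nbr c x y)
  nbr? c x y = ¬? (x ≟ y) ×-dec Any.any? (λ e → (x ∈ₑ? e) ×-dec (y ∈ₑ? e) ×-dec reach? c e) E

  Covers : Triple n → Fin n → Set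
  Covers c x = Σ (Fin n) (Nbr c x)

  covers? : ∀ c x → Dec (Covers c x)
  covers? c x = any? (nbr? c x)

  ∣N∣ : Triple n → Fin n → ℕ
  ∣N∣ c x = ∑[ y < n ] 𝟙 (nbr? c x y)

  covering-component : ∀ {c} → c ∈ E → (∀ v → Covers c v) → HasSpanningComponent G
  covering-component {c} c∈E covers = componentOf c , componentOf-isComponent c∈E , spanning
    where
    spanning : Spanning (componentOf c)
    spanning v with covers v
    ... | _ , _ , found with find found
    ...   | e , _ , v∈e , _ , c⇝e = e , c⇝e , v∈e

  nbr-sym : ∀ {c x y} → Nbr c x y → Nbr c y x
  nbr-sym (x≢y , found) = x≢y ∘ sym , Any.map (λ (x∈ , y∈ , c⇝e) → y∈ , x∈ , c⇝e) found

  link-swap : ∀ {x a b} → Link E x a b → Link E x b a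
  link-swap ((x≢a , a≢b , x≢b) , found) =
    (x≢b , a≢b ∘ sym , x≢a) , Any.map (λ (x∈ , a∈ , b∈) → x∈ , b∈ , a∈) found

  link-reached : ∀ {c x a b} → Link E x a b → Nbr c x a → Any (λ e → In₃ x a b e × Reach c e) E
  link-reached (_ , found) (x≢a , found′) with find found | find found′
  ... | e , e∈E , xab∈e@(x∈e , a∈e , _) | e′ , e′∈E , x∈e′ , a∈e′ , c⇝e′ =
    lose e∈E (xab∈e , c⇝e′ ++ʷ reach-sharing e′∈E e∈E x≢a x∈e′ a∈e′ x∈e a∈e)

  link-nbr : ∀ {c x a b} → Link E x a b → Nbr c x a → Nbr c x b
  link-nbr link@((_ , _ , x≢b) , _) x~a =
    x≢b , Any.map (λ ((x∈ , _ , b∈) , c⇝e) → x∈ , b∈ , c⇝e) (link-reached link x~a)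

  link-nbr-apex : ∀ {c x y a b} → Link E x a b → Link E y a b → Nbr c x a → Nbr c y a
  link-nbr-apex link ((y≢a , a≢b , _) , found) x~a with find (link-reached link x~a) | find found
  ... | e , e∈E , (_ , a∈e , b∈e) , c⇝e | f , f∈E , y∈f , a∈f , b∈f =
    y≢a , lose f∈E (y∈f , a∈f , c⇝e ++ʷ reach-sharing e∈E f∈E a≢b a∈e b∈e a∈f b∈f)

  single-edge-links : ∀ {x e} → Sorted e → x ∈ₑ e → 2 ≤ ∑∑ (λ a b → 𝟙 (link? (e ∷ []) x a b))
  single-edge-links {x} {e} sorted-e x∈e with Sorted-others sorted-e x∈e
  ... | y , z , d@(x≢y , y≢z , x≢z) , xyz∈e@(x∈ , y∈ , z∈) = begin
    1 + 1                              ≡⟨ cong₂ _+_ (𝟙-yes (link? (e ∷ []) x y z) (d , here xyz∈e))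
                                                    (𝟙-yes (link? (e ∷ []) x z y) xzy) ⟨
    link-at y z + link-at z y          ≤⟨ +-mono-≤ (sum-one (link-at y) z) (sum-one (link-at z) y) ⟩
    sum (link-at y) + sum (link-at z)  ≤⟨ sum-two (sum ∘ link-at) y≢z ⟩
    ∑∑ link-at                         ∎
    where
    open ≤-Reasoning
    xzy : Link (e ∷ []) x z y
    xzy = (x≢z , y≢z ∘ sym , x≢y) , here (x∈ , z∈ , y∈)
    link-at : Fin n → Fin n → ℕ
    link-at a b = 𝟙 (link? (e ∷ []) x a b)

  link-count : ∀ x (P? : Decidable (x ∈ₑ_)) xs → Unique xs → All Sorted xs →
               2 * length (filter P? xs) ≤ ∑∑ (λ a b → 𝟙 (link? xs x a b))
  link-count x P? []       _                  _                      = z≤n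
  link-count x P? (e ∷ xs) (e∉xs ∷ unique-xs) (sorted-e ∷ sorted-xs) with P? e
  ... | no _ = ≤-trans (link-count x P? xs unique-xs sorted-xs)
                 (∑∑-mono-≤ λ a b → 𝟙-mono (link? xs x a b) (link? (e ∷ xs) x a b) λ (d , found) → d , there found)
  ... | yes x∈e = begin
    2 * suc (length (filter P? xs))                     ≡⟨ *-suc 2 _ ⟩
    2 + 2 * length (filter P? xs)                       ≤⟨ +-mono-≤ (single-edge-links sorted-e x∈e)
                                                                     (link-count x P? xs unique-xs sorted-xs) ⟩
    ∑∑ (link-in (e ∷ [])) + ∑∑ (link-in xs)             ≡⟨ ∑∑-distrib-+ (link-in (e ∷ [])) (link-in xs) ⟨
    ∑∑ (λ a b → link-in (e ∷ []) a b + link-in xs a b)  ≤⟨ ∑∑-mono-≤ joined ⟩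
    ∑∑ (link-in (e ∷ xs))                               ∎
    where
    open ≤-Reasoning
    link-in : List (Triple n) → Fin n → Fin n → ℕ
    link-in ys a b = 𝟙 (link? ys x a b)
    here-link : ∀ {a b} → Link (e ∷ []) x a b → Link (e ∷ xs) x a b
    here-link (d , here xab∈e) = d , here xab∈e
    there-link : ∀ {a b} → Link xs x a b → Link (e ∷ xs) x a b
    there-link (d , found) = d , there found
    not-both : ∀ {a b} → ¬ (Link (e ∷ []) x a b × Link xs x a b)
    not-both ((d , here xab∈e) , (_ , found)) with find found
    ... | f , f∈xs , xab∈f = All-lookup e∉xs f∈xs (same-edge sorted-e (All-lookup sorted-xs f∈xs) d xab∈e xab∈f)
    joined : ∀ a b → link-in (e ∷ []) a b + link-in xs a b ≤ link-in (e ∷ xs) a b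
    joined a b = 𝟙-disjoint (link? (e ∷ []) x a b) (link? xs x a b) (link? (e ∷ xs) x a b) here-link there-link not-both

  link-degree : ∀ x → 2 * degree G x ≤ ∑∑ (λ a b → 𝟙 (link? E x a b))
  link-degree x = link-count x _ E (unique G) (sorted G)

  -- All link edges of x at a lie in the component of any one of them, whose neighbourhood of x
  -- contains a as well as their other ends.
  link-row : ∀ {x t} → (∀ {e} → e ∈ E → ∣N∣ e x ≤ t) → ∀ a → ∑[ b < n ] 𝟙 (link? E x a b) ≤ t ∸ 1
  link-row {x} {t} N≤t a with any? (link? E x a)
  ... | no no-link = ≤-trans (≤-reflexive (sum-zero λ b → 𝟙-no (link? E x a b) (no-link ∘ (b ,_)))) z≤n
  ... | yes (_ , (x≢a , _) , found) with find found
  ...   | e₀ , e₀∈E , x∈e₀ , a∈e₀ , _ = m+n≤o⇒m≤o∸n _ (begin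
    sum link-at + 1                        ≡⟨ cong (sum link-at +_) (sum-δ₁ a) ⟨
    sum link-at + ∑[ b < n ] 𝟙 (a ≟ b)     ≡⟨ ∑-distrib-+ link-at (λ b → 𝟙 (a ≟ b)) ⟨
    ∑[ b < n ] (link-at b + 𝟙 (a ≟ b))     ≤⟨ sum-mono-≤ in-component ⟩
    ∣N∣ e₀ x                                ≤⟨ N≤t e₀∈E ⟩
    t                                      ∎)
    where
    open ≤-Reasoning
    link-at : Fin n → ℕ
    link-at b = 𝟙 (link? E x a b)
    x~a : Nbr e₀ x a
    x~a = x≢a , lose e₀∈E (x∈e₀ , a∈e₀ , here e₀∈E)
    in-component : ∀ b → link-at b + 𝟙 (a ≟ b) ≤ 𝟙 (nbr? e₀ x b)
    in-component b = 𝟙-disjoint (link? E x a b) (a ≟ b) (nbr? e₀ x b)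
      (λ link → link-nbr link x~a) (λ { refl → x~a }) λ (((_ , a≢b , _) , _) , a≡b) → a≢b a≡b

  link-total : ∀ {x t} → (∀ {e} → e ∈ E → ∣N∣ e x ≤ t) →
               ∑∑ (λ a b → 𝟙 (link? E x a b)) ≤ (n ∸ 1) * (t ∸ 1)
  link-total {x} N≤t =
    sum-except x _ (sum-zero λ b → 𝟙-no (link? E x x b) λ ((x≢x , _) , _) → x≢x refl) (link-row N≤t)

  link-giant : ∀ {x t} → (∀ {e} → e ∈ E → ∣N∣ e x ≤ t) →
               (n ∸ 1) C 2 + 2 ≤ 2 * degree G x → (n ∸ 1) + 2 ≤ 2 * t
  link-giant {x} {t} N≤t large-degree =
    mC2+2≤m*[t∸1]⇒m+2≤2*t (n ∸ 1) t (≤-trans large-degree (≤-trans (link-degree x) (link-total N≤t)))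

-- The position of a vertex relative to the apexes u, w and the neighbourhoods S = N_c(u), T = N_c′(w).
data Kind : Set where
  apex-u apex-w both only-S only-T neither : Kind

code : Kind → ℕ
code apex-u  = 0
code apex-w  = 1
code both    = 2
code only-S  = 3
code only-T  = 4
code neither = 5

decode : ℕ → Kind
decode 0 = apex-u
decode 1 = apex-w
decode 2 = both
decode 3 = only-S
decode 4 = only-T
decode _ = neither

decode-code : ∀ k → decode (code k) ≡ k
decode-code apex-u  = refl
decode-code apex-w  = refl
decode-code both    = refl
decode-code only-S  = refl
decode-code only-T  = refl
decode-code neither = refl

-- Going through ℕ makes the indicators below compute on closed kinds.
_≟ₖ_ : DecidableEquality Kind
k ≟ₖ l = map′ (λ eq → trans (sym (decode-code k)) (trans (cong decode eq) (decode-code l)))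
              (cong code) (code k ℕ.≟ code l)

[_≐_] : Kind → Kind → ℕ
[ k ≐ l ] = 𝟙 (k ≟ₖ l)

not-w : Kind → ℕ
not-w k = 𝟙 (¬? (k ≟ₖ apex-w))

outside : Kind → ℕ
outside k = [ k ≐ only-T ] + [ k ≐ neither ]

crossing : Kind → Kind → ℕ
crossing k l = [ k ≐ only-S ] * [ l ≐ only-T ] + [ k ≐ only-T ] * [ l ≐ only-S ]
             + [ k ≐ both ] * [ l ≐ neither ] + [ k ≐ neither ] * [ l ≐ both ]

near : Kind → Kind → ℕ
near k l = not-w k * not-w l + [ k ≐ only-T ] * [ l ≐ only-T ] + [ k ≐ neither ] * [ l ≐ neither ]

via-w : Kind → Kind → ℕ
via-w k l = [ k ≐ apex-w ] * outside l + outside k * [ l ≐ apex-w ]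

crossing-diagonal : ∀ k → crossing k k ≡ 0
crossing-diagonal apex-u  = refl
crossing-diagonal apex-w  = refl
crossing-diagonal both    = refl
crossing-diagonal only-S  = refl
crossing-diagonal only-T  = refl
crossing-diagonal neither = refl

not-w-split : ∀ k → [ k ≐ both ] + [ k ≐ only-S ] + [ k ≐ only-T ] + [ k ≐ neither ] + [ k ≐ apex-u ] ≡ not-w k
not-w-split apex-u  = refl
not-w-split apex-w  = refl
not-w-split both    = refl
not-w-split only-S  = refl
not-w-split only-T  = refl
not-w-split neither = refl

module UncoveredVertex {m : ℕ} (G : ThreeGraph (suc m))
  (degrees : ∀ v → m C 2 + 2 ≤ 2 * degree G v)
  {u w : Fin (suc m)} {c c′ : Triple (suc m)}
  (w-uncovered : ¬ Tight.Covers G c w)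
  (c′-best : ∀ {e} → e ∈ edges G → Tight.∣N∣ G e w ≤ Tight.∣N∣ G c′ w)
  (c-best : Tight.∣N∣ G c′ w ≤ Tight.∣N∣ G c u)
  where

  open Tight G

  S T : Fin (suc m) → Set
  S = Nbr c u
  T = Nbr c′ w

  ¬S-w : ¬ S w
  ¬S-w u~w = w-uncovered (u , nbr-sym u~w)

  S⇒≢u : ∀ {x} → S x → x ≢ u
  S⇒≢u (u≢x , _) = u≢x ∘ sym

  S⇒≢w : ∀ {x} → S x → x ≢ w
  S⇒≢w Sx refl = ¬S-w Sx

  T⇒≢w : ∀ {x} → T x → x ≢ w
  T⇒≢w (w≢x , _) = w≢x ∘ sym

  ∣T∣-large : m + 2 ≤ 2 * ∣N∣ c′ w
  ∣T∣-large = link-giant c′-best (degrees w)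

  u≢w : u ≢ w
  u≢w refl =
    contradiction (≤-trans (m≤n+m 2 m) (≤-trans ∣T∣-large (*-monoʳ-≤ 2 (≤-trans c-best (≤-reflexive ∣N∣-w≡0))))) λ ()
    where
    ∣N∣-w≡0 : ∣N∣ c w ≡ 0
    ∣N∣-w≡0 = sum-zero λ y → 𝟙-no (nbr? c w y) λ w~y → w-uncovered (y , w~y)

  data KindOf (x : Fin (suc m)) : Kind → Set where
    is-u       : x ≡ u → KindOf x apex-u
    is-w       : x ≡ w → KindOf x apex-w
    is-both    : S x → T x → KindOf x both
    is-only-S  : S x → ¬ T x → KindOf x only-S
    is-only-T  : ¬ S x → T x → x ≢ u → KindOf x only-T
    is-neither : ¬ S x → ¬ T x → x ≢ u → x ≢ w → KindOf x neither

  classify : ∀ x → Σ Kind (KindOf x)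
  classify x with x ≟ u | x ≟ w | nbr? c u x | nbr? c′ w x
  ... | yes x≡u | _       | _      | _      = apex-u , is-u x≡u
  ... | no _    | yes x≡w | _      | _      = apex-w , is-w x≡w
  ... | no _    | no _    | yes Sx | yes Tx = both , is-both Sx Tx
  ... | no _    | no _    | yes Sx | no ¬Tx = only-S , is-only-S Sx ¬Tx
  ... | no x≢u  | no _    | no ¬Sx | yes Tx = only-T , is-only-T ¬Sx Tx x≢u
  ... | no x≢u  | no x≢w  | no ¬Sx | no ¬Tx = neither , is-neither ¬Sx ¬Tx x≢u x≢w

  kind : Fin (suc m) → Kind
  kind x = proj₁ (classify x)

  kindOf : ∀ x → KindOf x (kind x)
  kindOf x = proj₂ (classify x)

  ι : Kind → Fin (suc m) → ℕ
  ι K x = [ kind x ≐ K ]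

  count : Kind → ℕ
  count K = sum (ι K)

  #both #only-S #only-T #neither : ℕ
  #both = count both
  #only-S = count only-S
  #only-T = count only-T
  #neither = count neither

  count-apex-u : count apex-u ≡ 1
  count-apex-u = trans (sum-cong-≗ at-u) (sum-δ₁ u)
    where
    at-u : ∀ x → ι apex-u x ≡ 𝟙 (u ≟ x)
    at-u x with kind x | kindOf x
    ... | _ | is-u refl            = sym (𝟙-yes (u ≟ u) refl)
    ... | _ | is-w refl            = sym (𝟙-no (u ≟ w) u≢w)
    ... | _ | is-both Sx _         = sym (𝟙-no (u ≟ x) (S⇒≢u Sx ∘ sym))
    ... | _ | is-only-S Sx _       = sym (𝟙-no (u ≟ x) (S⇒≢u Sx ∘ sym))
    ... | _ | is-only-T _ _ x≢u    = sym (𝟙-no (u ≟ x) (x≢u ∘ sym))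
    ... | _ | is-neither _ _ x≢u _ = sym (𝟙-no (u ≟ x) (x≢u ∘ sym))

  count-apex-w : count apex-w ≡ 1
  count-apex-w = trans (sum-cong-≗ at-w) (sum-δ₁ w)
    where
    at-w : ∀ x → ι apex-w x ≡ 𝟙 (w ≟ x)
    at-w x with kind x | kindOf x
    ... | _ | is-u refl            = sym (𝟙-no (w ≟ u) (u≢w ∘ sym))
    ... | _ | is-w refl            = sym (𝟙-yes (w ≟ w) refl)
    ... | _ | is-both Sx _         = sym (𝟙-no (w ≟ x) (S⇒≢w Sx ∘ sym))
    ... | _ | is-only-S Sx _       = sym (𝟙-no (w ≟ x) (S⇒≢w Sx ∘ sym))
    ... | _ | is-only-T _ Tx _     = sym (𝟙-no (w ≟ x) (T⇒≢w Tx ∘ sym))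
    ... | _ | is-neither _ _ _ x≢w = sym (𝟙-no (w ≟ x) (x≢w ∘ sym))

  ∣S∣≡#both+#only-S : ∣N∣ c u ≡ #both + #only-S
  ∣S∣≡#both+#only-S = trans (sum-cong-≗ in-S) (∑-distrib-+ (ι both) (ι only-S))
    where
    in-S : ∀ x → 𝟙 (nbr? c u x) ≡ ι both x + ι only-S x
    in-S x with kind x | kindOf x
    ... | _ | is-u refl            = 𝟙-no (nbr? c u u) λ (u≢u , _) → u≢u refl
    ... | _ | is-w refl            = 𝟙-no (nbr? c u w) ¬S-w
    ... | _ | is-both Sx _         = 𝟙-yes (nbr? c u x) Sx
    ... | _ | is-only-S Sx _       = 𝟙-yes (nbr? c u x) Sx
    ... | _ | is-only-T ¬Sx _ _    = 𝟙-no (nbr? c u x) ¬Sx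
    ... | _ | is-neither ¬Sx _ _ _ = 𝟙-no (nbr? c u x) ¬Sx

  #both+#only-T≤∣T∣ : #both + #only-T ≤ ∣N∣ c′ w
  #both+#only-T≤∣T∣ = ≤-trans (≤-reflexive (sym (∑-distrib-+ (ι both) (ι only-T)))) (sum-mono-≤ in-T)
    where
    in-T : ∀ x → ι both x + ι only-T x ≤ 𝟙 (nbr? c′ w x)
    in-T x with kind x | kindOf x
    ... | _ | is-u refl          = z≤n
    ... | _ | is-w refl          = z≤n
    ... | _ | is-both _ Tx       = ≤-reflexive (sym (𝟙-yes (nbr? c′ w x) Tx))
    ... | _ | is-only-S _ _      = z≤n
    ... | _ | is-only-T _ Tx _   = ≤-reflexive (sym (𝟙-yes (nbr? c′ w x) Tx))
    ... | _ | is-neither _ _ _ _ = z≤n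

  ∣T∣≤#both+#only-T+1 : ∣N∣ c′ w ≤ #both + #only-T + 1
  ∣T∣≤#both+#only-T+1 = ≤-trans (sum-mono-≤ in-T) (≤-reflexive
    (trans (∑-distrib-+ (λ x → ι both x + ι only-T x) (ι apex-u)) (cong₂ _+_ (∑-distrib-+ (ι both) (ι only-T)) count-apex-u)))
    where
    in-T : ∀ x → 𝟙 (nbr? c′ w x) ≤ ι both x + ι only-T x + ι apex-u x
    in-T x with kind x | kindOf x
    ... | _ | is-u refl            = 𝟙≤1 (nbr? c′ w u)
    ... | _ | is-w refl            = ≤-reflexive (𝟙-no (nbr? c′ w w) λ (w≢w , _) → w≢w refl)
    ... | _ | is-both _ _          = 𝟙≤1 (nbr? c′ w x)
    ... | _ | is-only-S _ ¬Tx      = ≤-reflexive (𝟙-no (nbr? c′ w x) ¬Tx)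
    ... | _ | is-only-T _ _ _      = 𝟙≤1 (nbr? c′ w x)
    ... | _ | is-neither _ ¬Tx _ _ = ≤-reflexive (𝟙-no (nbr? c′ w x) ¬Tx)

  ∑not-w≡m : sum (not-w ∘ kind) ≡ m
  ∑not-w≡m = suc-injective (begin
    suc (sum (not-w ∘ kind))                         ≡⟨ +-comm 1 _ ⟩
    sum (not-w ∘ kind) + 1                           ≡⟨ cong (sum (not-w ∘ kind) +_) count-apex-w ⟨
    sum (not-w ∘ kind) + count apex-w                ≡⟨ ∑-distrib-+ (not-w ∘ kind) (ι apex-w) ⟨
    ∑[ x < suc m ] (not-w (kind x) + ι apex-w x)     ≡⟨ sum-cong-≗ (λ x → 𝟙-¬+𝟙 (kind x ≟ₖ apex-w)) ⟩
    ∑[ x < suc m ] 1                                 ≡⟨ sum-const (suc m) 1 ⟩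
    suc m * 1                                        ≡⟨ *-identityʳ (suc m) ⟩
    suc m                                            ∎)
    where open ≡-Reasoning

  #both+#only-S+#only-T+#neither+1≡m : #both + #only-S + #only-T + #neither + 1 ≡ m
  #both+#only-S+#only-T+#neither+1≡m = begin
    #both + #only-S + #only-T + #neither + 1
      ≡⟨ cong (#both + #only-S + #only-T + #neither +_) count-apex-u ⟨
    #both + #only-S + #only-T + #neither + count apex-u
      ≡⟨ distrib ⟨
    ∑[ x < suc m ] (ι both x + ι only-S x + ι only-T x + ι neither x + ι apex-u x)
      ≡⟨ sum-cong-≗ (not-w-split ∘ kind) ⟩
    sum (not-w ∘ kind)
      ≡⟨ ∑not-w≡m ⟩
    m ∎
    where
    open ≡-Reasoning
    distrib : ∑[ x < suc m ] (ι both x + ι only-S x + ι only-T x + ι neither x + ι apex-u x)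
            ≡ #both + #only-S + #only-T + #neither + count apex-u
    distrib =
      trans (∑-distrib-+ (λ x → ι both x + ι only-S x + ι only-T x + ι neither x) (ι apex-u)) (cong (_+ count apex-u)
      (trans (∑-distrib-+ (λ x → ι both x + ι only-S x + ι only-T x) (ι neither)) (cong (_+ #neither)
      (trans (∑-distrib-+ (λ x → ι both x + ι only-S x) (ι only-T)) (cong (_+ #only-T)
      (∑-distrib-+ (ι both) (ι only-S)))))))

  #only-T≤#only-S : #only-T ≤ #only-S
  #only-T≤#only-S =
    +-cancelˡ-≤ #both _ _ (≤-trans #both+#only-T≤∣T∣ (≤-trans c-best (≤-reflexive ∣S∣≡#both+#only-S)))

  #neither≤#both : #neither ≤ #both
  #neither≤#both = ≤-trans (m≤m+n _ 2) (+-cancelˡ-≤ (#both + #only-S + #only-T + 1) _ _ (begin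
    #both + #only-S + #only-T + 1 + (#neither + 2)  ≡⟨ shuffle #both #only-S #only-T #neither ⟩
    #both + #only-S + #only-T + #neither + 1 + 2    ≡⟨ cong (_+ 2) #both+#only-S+#only-T+#neither+1≡m ⟩
    m + 2                                           ≤⟨ ∣T∣-large ⟩
    2 * t                                           ≡⟨ cong (t +_) (+-identityʳ t) ⟩
    t + t                                           ≤⟨ +-mono-≤ ∣T∣≤#both+#only-T+1 (≤-trans c-best (≤-reflexive ∣S∣≡#both+#only-S)) ⟩
    (#both + #only-T + 1) + (#both + #only-S)       ≡⟨ regroup #both #only-S #only-T ⟩
    #both + #only-S + #only-T + 1 + #both           ∎))
    where
    open ≤-Reasoning
    t : ℕ
    t = ∣N∣ c′ w
    shuffle : ∀ i a b r → i + a + b + 1 + (r + 2) ≡ i + a + b + r + 1 + 2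
    shuffle = solve-∀
    regroup : ∀ i a b → (i + b + 1) + (i + a) ≡ i + a + b + 1 + i
    regroup = solve-∀

  links : Fin (suc m) → Fin (suc m) → ℕ
  links a b = 𝟙 (link? E u a b) + 𝟙 (link? E w a b)

  no-link : ∀ {a b k} → ¬ Link E u a b → ¬ Link E w a b → links a b + k ≤ k
  no-link {a} {b} {k} ¬ℓu ¬ℓw =
    ≤-reflexive (cong (_+ k) (cong₂ _+_ (𝟙-no (link? E u a b) ¬ℓu) (𝟙-no (link? E w a b) ¬ℓw)))

  one-link : ∀ {a b} → ¬ (Link E u a b × Link E w a b) → links a b + 0 ≤ 1
  one-link {a} {b} ¬both = ≤-trans (≤-reflexive (+-identityʳ _)) (𝟙-exclusive (link? E u a b) (link? E w a b) ¬both)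

  two-links : ∀ {a b} → links a b + 0 ≤ 2
  two-links {a} {b} = ≤-trans (≤-reflexive (+-identityʳ _)) (+-mono-≤ (𝟙≤1 (link? E u a b)) (𝟙≤1 (link? E w a b)))

  no-loop : ∀ {x a} → ¬ Link E x a a
  no-loop ((_ , a≢a , _) , _) = a≢a refl

  no-apex-first : ∀ {x b} → ¬ Link E x x b
  no-apex-first ((x≢x , _) , _) = x≢x refl

  no-apex-last : ∀ {x a} → ¬ Link E x a x
  no-apex-last ((_ , _ , x≢x) , _) = x≢x refl

  S-closed : ∀ {a b} → Link E u a b → S a → S b
  S-closed = link-nbr

  S-closed′ : ∀ {a b} → Link E u a b → S b → S a
  S-closed′ = link-nbr ∘ link-swap

  T-closed : ∀ {a b} → Link E w a b → T a → T b
  T-closed = link-nbr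

  T-closed′ : ∀ {a b} → Link E w a b → T b → T a
  T-closed′ = link-nbr ∘ link-swap

  shared-pair : ∀ {a b} → Link E u a b → Link E w a b → ¬ S a
  shared-pair ℓu ℓw Sa = w-uncovered (_ , link-nbr-apex ℓu ℓw Sa)

  -- An edge uab keeps a, b on one side of S, an edge wab keeps them on one side of T, and both are
  -- edges only if a, b ∉ S; so a crossing pair carries no edge and a pair within S at most one.
  off-diagonal : ∀ a b → a ≢ b →
                 links a b + crossing (kind a) (kind b) ≤ 1 * near (kind a) (kind b) + via-w (kind a) (kind b)
  off-diagonal a b a≢b with kind a | kindOf a | kind b | kindOf b
  ... | _ | is-u refl              | _ | is-u refl              = ⊥-elim (a≢b refl)
  ... | _ | is-u refl              | _ | is-w refl              = no-link no-apex-first no-apex-last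
  ... | _ | is-u refl              | _ | is-both _ _            = one-link (no-apex-first ∘ proj₁)
  ... | _ | is-u refl              | _ | is-only-S _ _          = one-link (no-apex-first ∘ proj₁)
  ... | _ | is-u refl              | _ | is-only-T _ _ _        = one-link (no-apex-first ∘ proj₁)
  ... | _ | is-u refl              | _ | is-neither _ _ _ _     = one-link (no-apex-first ∘ proj₁)
  ... | _ | is-w refl              | _ | is-u refl              = no-link no-apex-last no-apex-first
  ... | _ | is-w refl              | _ | is-w refl              = ⊥-elim (a≢b refl)
  ... | _ | is-w refl              | _ | is-both Sb _           = no-link (λ ℓ → ¬S-w (S-closed′ ℓ Sb)) no-apex-first
  ... | _ | is-w refl              | _ | is-only-S Sb _         = no-link (λ ℓ → ¬S-w (S-closed′ ℓ Sb)) no-apex-first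
  ... | _ | is-w refl              | _ | is-only-T _ _ _        = one-link (no-apex-first ∘ proj₂)
  ... | _ | is-w refl              | _ | is-neither _ _ _ _     = one-link (no-apex-first ∘ proj₂)
  ... | _ | is-both _ _            | _ | is-u refl              = one-link (no-apex-last ∘ proj₁)
  ... | _ | is-both Sa _           | _ | is-w refl              = no-link (λ ℓ → ¬S-w (S-closed ℓ Sa)) no-apex-last
  ... | _ | is-both Sa _           | _ | is-both _ _            = one-link λ (ℓu , ℓw) → shared-pair ℓu ℓw Sa
  ... | _ | is-both _ Ta           | _ | is-only-S _ ¬Tb        = one-link λ (_ , ℓw) → ¬Tb (T-closed ℓw Ta)
  ... | _ | is-both Sa _           | _ | is-only-T ¬Sb _ _      = one-link λ (ℓu , _) → ¬Sb (S-closed ℓu Sa)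
  ... | _ | is-both Sa Ta          | _ | is-neither ¬Sb ¬Tb _ _ = no-link (λ ℓ → ¬Sb (S-closed ℓ Sa)) (λ ℓ → ¬Tb (T-closed ℓ Ta))
  ... | _ | is-only-S _ _          | _ | is-u refl              = one-link (no-apex-last ∘ proj₁)
  ... | _ | is-only-S Sa _         | _ | is-w refl              = no-link (λ ℓ → ¬S-w (S-closed ℓ Sa)) no-apex-last
  ... | _ | is-only-S _ ¬Ta        | _ | is-both _ Tb           = one-link λ (_ , ℓw) → ¬Ta (T-closed′ ℓw Tb)
  ... | _ | is-only-S Sa _         | _ | is-only-S _ _          = one-link λ (ℓu , ℓw) → shared-pair ℓu ℓw Sa
  ... | _ | is-only-S Sa ¬Ta       | _ | is-only-T ¬Sb Tb _     = no-link (λ ℓ → ¬Sb (S-closed ℓ Sa)) (λ ℓ → ¬Ta (T-closed′ ℓ Tb))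
  ... | _ | is-only-S Sa _         | _ | is-neither ¬Sb _ _ _   = one-link λ (ℓu , _) → ¬Sb (S-closed ℓu Sa)
  ... | _ | is-only-T _ _ _        | _ | is-u refl              = one-link (no-apex-last ∘ proj₁)
  ... | _ | is-only-T _ _ _        | _ | is-w refl              = one-link (no-apex-last ∘ proj₂)
  ... | _ | is-only-T ¬Sa _ _      | _ | is-both Sb _           = one-link λ (ℓu , _) → ¬Sa (S-closed′ ℓu Sb)
  ... | _ | is-only-T ¬Sa Ta _     | _ | is-only-S Sb ¬Tb       = no-link (λ ℓ → ¬Sa (S-closed′ ℓ Sb)) (λ ℓ → ¬Tb (T-closed ℓ Ta))
  ... | _ | is-only-T _ _ _        | _ | is-only-T _ _ _        = two-links
  ... | _ | is-only-T _ Ta _       | _ | is-neither _ ¬Tb _ _   = one-link λ (_ , ℓw) → ¬Tb (T-closed ℓw Ta)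
  ... | _ | is-neither _ _ _ _     | _ | is-u refl              = one-link (no-apex-last ∘ proj₁)
  ... | _ | is-neither _ _ _ _     | _ | is-w refl              = one-link (no-apex-last ∘ proj₂)
  ... | _ | is-neither ¬Sa ¬Ta _ _ | _ | is-both Sb Tb          = no-link (λ ℓ → ¬Sa (S-closed′ ℓ Sb)) (λ ℓ → ¬Ta (T-closed′ ℓ Tb))
  ... | _ | is-neither ¬Sa _ _ _   | _ | is-only-S Sb _         = one-link λ (ℓu , _) → ¬Sa (S-closed′ ℓu Sb)
  ... | _ | is-neither _ ¬Ta _ _   | _ | is-only-T _ Tb _       = one-link λ (_ , ℓw) → ¬Ta (T-closed′ ℓw Tb)
  ... | _ | is-neither _ _ _ _     | _ | is-neither _ _ _ _     = two-links

  apart : Fin (suc m) → Fin (suc m) → ℕ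
  apart a b = 𝟙 (¬? (a ≟ b))

  pointwise : ∀ a b → links a b + crossing (kind a) (kind b) ≤ apart a b * near (kind a) (kind b) + via-w (kind a) (kind b)
  pointwise a b = by-cases (a ≟ b)
    where
    Goal : ℕ → Set
    Goal d = links a b + crossing (kind a) (kind b) ≤ d * near (kind a) (kind b) + via-w (kind a) (kind b)
    by-cases : Dec (a ≡ b) → Goal (apart a b)
    by-cases (yes refl) = ≤-trans (≤-reflexive diagonal) z≤n
      where
      diagonal : links a a + crossing (kind a) (kind a) ≡ 0
      diagonal = cong₂ _+_ (cong₂ _+_ (𝟙-no (link? E u a a) no-loop) (𝟙-no (link? E w a a) no-loop)) (crossing-diagonal (kind a))
    by-cases (no a≢b)   = subst Goal (sym (𝟙-yes (¬? (a ≟ b)) a≢b)) (off-diagonal a b a≢b)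

  crossing-total : ∑∑ (λ a b → crossing (kind a) (kind b))
                 ≡ #only-S * #only-T + #only-T * #only-S + #both * #neither + #neither * #both
  crossing-total = begin
    ∑∑ (λ a b → ST a b + TS a b + BN a b + NB a b)
      ≡⟨ trans (∑∑-distrib-+ (λ a b → ST a b + TS a b + BN a b) NB) (cong (_+ ∑∑ NB)
        (trans (∑∑-distrib-+ (λ a b → ST a b + TS a b) BN) (cong (_+ ∑∑ BN) (∑∑-distrib-+ ST TS)))) ⟩
    ∑∑ ST + ∑∑ TS + ∑∑ BN + ∑∑ NB
      ≡⟨ cong₂ _+_ (cong₂ _+_ (cong₂ _+_ (∑∑-product (ι only-S) (ι only-T)) (∑∑-product (ι only-T) (ι only-S)))
                              (∑∑-product (ι both) (ι neither))) (∑∑-product (ι neither) (ι both)) ⟩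
    #only-S * #only-T + #only-T * #only-S + #both * #neither + #neither * #both ∎
    where
    open ≡-Reasoning
    ST TS BN NB : Fin (suc m) → Fin (suc m) → ℕ
    ST a b = ι only-S a * ι only-T b
    TS a b = ι only-T a * ι only-S b
    BN a b = ι both a * ι neither b
    NB a b = ι neither a * ι both b

  off-not-w off-only-T off-neither : Fin (suc m) → Fin (suc m) → ℕ
  off-not-w a b = apart a b * (not-w (kind a) * not-w (kind b))
  off-only-T a b = apart a b * (ι only-T a * ι only-T b)
  off-neither a b = apart a b * (ι neither a * ι neither b)

  room-total : ∑∑ (λ a b → apart a b * near (kind a) (kind b) + via-w (kind a) (kind b))
             ≡ ∑∑ off-not-w + ∑∑ off-only-T + ∑∑ off-neither + (1 * (#only-T + #neither) + (#only-T + #neither) * 1)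
  room-total = begin
    ∑∑ (λ a b → apart a b * near (kind a) (kind b) + via-w (kind a) (kind b))
      ≡⟨ ∑∑-distrib-+ (λ a b → apart a b * near (kind a) (kind b)) (λ a b → via-w (kind a) (kind b)) ⟩
    ∑∑ (λ a b → apart a b * near (kind a) (kind b)) + ∑∑ (λ a b → via-w (kind a) (kind b))
      ≡⟨ cong₂ _+_ near-part via-w-part ⟩
    ∑∑ off-not-w + ∑∑ off-only-T + ∑∑ off-neither + (1 * (#only-T + #neither) + (#only-T + #neither) * 1) ∎
    where
    open ≡-Reasoning
    distrib : ∀ a b → apart a b * near (kind a) (kind b) ≡ off-not-w a b + off-only-T a b + off-neither a b
    distrib a b =
      trans (*-distribˡ-+ (apart a b) (not-w (kind a) * not-w (kind b) + ι only-T a * ι only-T b) (ι neither a * ι neither b))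
            (cong (_+ off-neither a b) (*-distribˡ-+ (apart a b) (not-w (kind a) * not-w (kind b)) (ι only-T a * ι only-T b)))
    near-part : ∑∑ (λ a b → apart a b * near (kind a) (kind b)) ≡ ∑∑ off-not-w + ∑∑ off-only-T + ∑∑ off-neither
    near-part = trans (sum-cong-≗ λ a → sum-cong-≗ (distrib a))
                      (trans (∑∑-distrib-+ (λ a b → off-not-w a b + off-only-T a b) off-neither) (cong (_+ ∑∑ off-neither) (∑∑-distrib-+ off-not-w off-only-T)))
    via-w-part : ∑∑ (λ a b → via-w (kind a) (kind b)) ≡ 1 * (#only-T + #neither) + (#only-T + #neither) * 1
    via-w-part = begin
      ∑∑ (λ a b → via-w (kind a) (kind b))
        ≡⟨ ∑∑-distrib-+ (λ a b → ι apex-w a * outside (kind b)) (λ a b → outside (kind a) * ι apex-w b) ⟩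
      ∑∑ (λ a b → ι apex-w a * outside (kind b)) + ∑∑ (λ a b → outside (kind a) * ι apex-w b)
        ≡⟨ cong₂ _+_ (∑∑-product (ι apex-w) (outside ∘ kind)) (∑∑-product (outside ∘ kind) (ι apex-w)) ⟩
      count apex-w * sum (outside ∘ kind) + sum (outside ∘ kind) * count apex-w
        ≡⟨ cong₂ (λ W O → W * O + O * W) count-apex-w (∑-distrib-+ (ι only-T) (ι neither)) ⟩
      1 * (#only-T + #neither) + (#only-T + #neither) * 1 ∎

  counted : (m C 2 + 2) + (m C 2 + 2) + (#only-S * #only-T + #only-T * #only-S + #both * #neither + #neither * #both)
            ≤ ∑∑ off-not-w + ∑∑ off-only-T + ∑∑ off-neither + (1 * (#only-T + #neither) + (#only-T + #neither) * 1)
  counted = begin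
    (m C 2 + 2) + (m C 2 + 2) + X
      ≤⟨ +-monoˡ-≤ X (+-mono-≤ (link-bound u) (link-bound w)) ⟩
    ∑∑ ℓu + ∑∑ ℓw + X
      ≡⟨ cong (∑∑ ℓu + ∑∑ ℓw +_) crossing-total ⟨
    ∑∑ ℓu + ∑∑ ℓw + ∑∑ cross
      ≡⟨ trans (∑∑-distrib-+ links cross) (cong (_+ ∑∑ cross) (∑∑-distrib-+ ℓu ℓw)) ⟨
    ∑∑ (λ a b → links a b + cross a b)
      ≤⟨ ∑∑-mono-≤ pointwise ⟩
    ∑∑ (λ a b → apart a b * near (kind a) (kind b) + via-w (kind a) (kind b))
      ≡⟨ room-total ⟩
    ∑∑ off-not-w + ∑∑ off-only-T + ∑∑ off-neither + (1 * (#only-T + #neither) + (#only-T + #neither) * 1) ∎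
    where
    open ≤-Reasoning
    ℓu ℓw cross : Fin (suc m) → Fin (suc m) → ℕ
    ℓu a b = 𝟙 (link? E u a b)
    ℓw a b = 𝟙 (link? E w a b)
    cross a b = crossing (kind a) (kind b)
    link-bound : ∀ x → m C 2 + 2 ≤ ∑∑ (λ a b → 𝟙 (link? E x a b))
    link-bound x = ≤-trans (degrees x) (link-degree x)
    X : ℕ
    X = #only-S * #only-T + #only-T * #only-S + #both * #neither + #neither * #both

  impossible : ⊥
  impossible = no-room {ON = ∑∑ off-not-w} {OB = ∑∑ off-only-T} {OR = ∑∑ off-neither} #only-T≤#only-S #neither≤#both
    (subst (λ s → ∑∑ off-not-w + s ≡ s * s) ∑not-w≡m (∑∑-offDiagonal (not-w ∘ kind) (λ a → 𝟙-idem (¬? (kind a ≟ₖ apex-w)))))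
    (∑∑-offDiagonal (ι only-T) (λ a → 𝟙-idem (kind a ≟ₖ only-T)))
    (∑∑-offDiagonal (ι neither) (λ a → 𝟙-idem (kind a ≟ₖ neither)))
    counted

maximal-pair-covers : ∀ {m} (G : ThreeGraph (suc m)) → (∀ v → m C 2 + 2 ≤ 2 * degree G v) →
                      ∀ {u c} → c ∈ edges G → (∀ {x e} → e ∈ edges G → Tight.∣N∣ G e x ≤ Tight.∣N∣ G c u) →
                      ∀ w → Tight.Covers G c w
maximal-pair-covers G degrees {u} {c} c∈E c-max w with Tight.covers? G c w
... | yes covered   = covered
... | no uncovered = ⊥-elim (UncoveredVertex.impossible G degrees uncovered c′-best (c-max (argmax-∈ N-w c∈E)))
  where
  open Tight G
  N-w : Triple _ → ℕ
  N-w e = ∣N∣ e w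
  c′-best : ∀ {e} → e ∈ E → ∣N∣ e w ≤ ∣N∣ (argmax N-w c E) w
  c′-best = argmax-maximal N-w

theorem1p2 : ∀ (n : ℕ) (G : ThreeGraph n) →
    (∀ v → ((n ∸ 1) C 2) + 2 ≤ 2 * degree G v) →
    HasSpanningComponent G
theorem1p2 zero    G _       = no-vertices G
theorem1p2 (suc m) G degrees = covering-component c∈E (maximal-pair-covers G degrees c∈E c-max)
  where
  open Tight G
  edge₀ : Σ (Triple (suc m)) (_∈ E)
  edge₀ = filter-nonempty _ E (*-cancelˡ-≤ 2 (≤-trans (m≤n+m 2 (m C 2)) (degrees zero)))
  size : Fin (suc m) × Triple (suc m) → ℕ
  size (x , e) = ∣N∣ e x
  pairs : List (Fin (suc m) × Triple (suc m))
  pairs = cartesianProduct (allFin (suc m)) E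
  best : Fin (suc m) × Triple (suc m)
  best = argmax size (zero , proj₁ edge₀) pairs
  c∈E : proj₂ best ∈ E
  c∈E = proj₂ (∈-cartesianProduct⁻ (allFin (suc m)) E (argmax-∈ size (∈-cartesianProduct⁺ (∈-allFin zero) (proj₂ edge₀))))
  c-max : ∀ {x e} → e ∈ E → ∣N∣ e x ≤ ∣N∣ (proj₂ best) (proj₁ best)
  c-max {x} e∈E = argmax-maximal size (∈-cartesianProduct⁺ (∈-allFin x) e∈E)
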